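{- For every integer $n\geq 3$, let $W_n$ be the wheel of order $n+1$ (a cycle $C_n$ together with one extra vertex adjacent to all vertices of the cycle). Then $$\chi_d^{tt}(W_n)=\begin{cases} n+2 & \text{if } 3\leq n\leq 7,\\ n+1 & \text{if } n\geq 8.\end{cases}$$
   Context: All graphs are finite, simple and undirected. For a graph $G=(V,E)$ call the elements of $V\cup E$ objects; two vertices are adjacent if joined by an edge, two edges are adjacent if they share an endpoint, and a vertex and an edge are incident if the vertex is an endpoint of the edge. A total coloring of $G$ assigns a color to every object so that any two adjacent or incident objects receive different colors; a color class is the set of all objects of one color. A total dominator total coloring of a graph $G$ with positive minimum degree is a total coloring of $G$ in which every object of $G$ is adjacent or incident to every object of some color class. The total dominator total chromatic number $\chi_d^{tt}(G)$ is the minimum number of color classes in a total dominator total coloring of $G$. -}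

module Defs where

open import Data.Nat as ℕ using (ℕ; zero; suc)
open import Data.Nat.Properties using (_≟_)
open import Data.Fin using (Fin; toℕ; _<_)
open import Data.Bool using (Bool; true; false; T; _∨_; _∧_; not)
open import Data.Product using (Σ; ∃; _×_; _,_)
open import Data.Sum using (_⊎_)
open import Relation.Nullary using (¬_; yes; no)
open import Data.Empty using (⊥-elim)
open import Data.Bool.Properties using (∨-comm; ∧-zeroʳ)
open import Relation.Nullary.Decidable using (⌊_⌋)
open import Relation.Binary.PropositionalEquality as ≡ using (_≡_; refl; cong; cong₂)
open import Function.Definitions using (Surjective)

record Graph : Set where
  field
    N      : ℕ
    adj    : Fin N → Fin N → Bool
    sym    : ∀ u v → adj u v ≡ adj v u
    irrefl : ∀ v → adj v v ≡ false

module _ (G : Graph) where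
  open Graph G

  -- An edge {u,v} is represented once, with u < v.
  data Object : Set where
    vtx : Fin N → Object
    edg : (u v : Fin N) → u < v → T (adj u v) → Object

  Related : Object → Object → Set
  Related (vtx u) (vtx v) = T (adj u v)
  Related (vtx w) (edg u v _ _) = w ≡ u ⊎ w ≡ v
  Related (edg u v _ _) (vtx w) = w ≡ u ⊎ w ≡ v
  Related e@(edg u v _ _) f@(edg u' v' _ _) =
    ¬ (e ≡ f) × (u ≡ u' ⊎ u ≡ v' ⊎ v ≡ u' ⊎ v ≡ v')

  PositiveMinDegree : Set
  PositiveMinDegree = ∀ v → ∃ λ w → T (adj v w)

  -- A total coloring with exactly k (nonempty) color classes.
  IsTotalColoring : (k : ℕ) → (Object → Fin k) → Set
  IsTotalColoring k c =
    Surjective _≡_ _≡_ c × (∀ x y → Related x y → ¬ (c x ≡ c y))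

  IsTotalDominator : (k : ℕ) → (Object → Fin k) → Set
  IsTotalDominator k c = ∀ x → ∃ λ (i : Fin k) → ∀ y → c y ≡ i → Related x y

  IsTDTColoring : (k : ℕ) → (Object → Fin k) → Set
  IsTDTColoring k c = IsTotalColoring k c × IsTotalDominator k c

  HasTDTColoring : ℕ → Set
  HasTDTColoring k = Σ (Object → Fin k) (IsTDTColoring k)

  χdtt≡ : ℕ → Set
  χdtt≡ m = HasTDTColoring m × (∀ k → HasTDTColoring k → m ℕ.≤ k)

-- Wheel W_n (n ≥ 3) on vertex set Fin (suc n): vertex 0 is the hub,
-- vertices 1..n form the cycle 1-2-...-n-1.
-- Directed "generator" relation: hub → every cycle vertex, and
-- cycle vertex i → i+1 (with n → 1).
arcℕ : ℕ → ℕ → ℕ → Bool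
arcℕ n zero zero = false
arcℕ n zero (suc b) = true
arcℕ n (suc a) zero = false
arcℕ n (suc a) (suc b) = ⌊ b ≟ suc a ⌋ ∨ (⌊ suc a ≟ n ⌋ ∧ ⌊ b ≟ 0 ⌋)

wadjℕ : ℕ → ℕ → ℕ → Bool
wadjℕ n a b = (arcℕ n a b ∨ arcℕ n b a) ∧ not ⌊ a ≟ b ⌋

private
  ≟-sym : ∀ a b → ⌊ a ≟ b ⌋ ≡ ⌊ b ≟ a ⌋
  ≟-sym a b with a ≟ b | b ≟ a
  ... | yes _ | yes _ = refl
  ... | yes p | no ¬q = ⊥-elim (¬q (≡.sym p))
  ... | no ¬p | yes q = ⊥-elim (¬p (≡.sym q))
  ... | no _ | no _ = refl

  ≟-refl : ∀ a → ⌊ a ≟ a ⌋ ≡ true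
  ≟-refl a with a ≟ a
  ... | yes _ = refl
  ... | no ¬p = ⊥-elim (¬p refl)

Wheel : ℕ → Graph
Wheel n = record
  { N = suc n
  ; adj = λ u v → wadjℕ n (toℕ u) (toℕ v)
  ; sym = λ u v → cong₂ _∧_ (∨-comm (arcℕ n (toℕ u) (toℕ v)) _)
                            (cong not (≟-sym (toℕ u) (toℕ v)))
  ; irrefl = λ v → ≡.trans (cong (λ z → (arcℕ n (toℕ v) (toℕ v) ∨ arcℕ n (toℕ v) (toℕ v)) ∧ not z) (≟-refl (toℕ v)))
                          (∧-zeroʳ _)
  }

module Submission where

open import Defs
open import Data.Bool using (Bool; true; false; T; not; _∧_; _∨_; if_then_else_)
open import Data.Bool.ListAction using (any)
open import Data.Bool.Properties using (T-irrelevant)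
open import Data.Fin as Fin using (Fin; zero; suc; toℕ; fromℕ; fromℕ<; punchOut)
open import Data.Fin.Properties as Finₚ
  using (toℕ<n; toℕ-injective; toℕ-fromℕ; toℕ-fromℕ<; injective⇒≤; punchOut-injective)
open import Data.Fin.Subset using (Subset; _∈_; ⊤; _-_)
open import Data.Fin.Subset.Properties using (nonempty?; ∈⊤; x∈p∧x≢y⇒x∈p-y)
open import Data.List using (List; []; _∷_; [_]; map; concatMap; allFin)
open import Data.List.Membership.Propositional using (find; lose) renaming (_∈_ to _∈ₗ_)
open import Data.List.Membership.Propositional.Properties using (∈-allFin; ∈-concatMap⁺)
open import Data.List.Relation.Unary.All as All using (All; []; _∷_)
import Data.List.Relation.Unary.All.Properties as Allₚ
open import Data.List.Relation.Unary.Any as Any using (Any; here; there)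
open import Data.List.Relation.Unary.Any.Properties using (any⁺; any⁻)
open import Data.Nat as ℕ using (ℕ; zero; suc; _+_; _*_; _≤_; _<_; z≤n; s≤s; s≤s⁻¹; parity)
open import Data.Nat.Properties as ℕₚ using (_≟_)
open import Data.Parity.Base using (0ℙ; 1ℙ; _⁻¹)
open import Data.Parity.Properties using (suc-homo-⁻¹)
open import Data.Product using (∃; _×_; _,_; proj₁; proj₂)
open import Data.Sum as Sum using (_⊎_; inj₁; inj₂; [_,_]′)
open import Function using (_∘_)
open import Function.Definitions using (Injective; Surjective)
open import Function.Consequences.Propositional
  using (strictlySurjective⇒surjective; surjective⇒strictlySurjective)
open import Relation.Binary using (DecidableEquality)
open import Relation.Nullary using (¬_; Dec; yes; no; does; contradiction)
open import Relation.Nullary.Decidable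
  using (True; ⌊_⌋; map′; _×-dec_; _⊎-dec_; _→-dec_; ¬?; T?; toWitness; dec-true; dec-false)
open import Relation.Binary.PropositionalEquality
  using (_≡_; _≢_; refl; sym; trans; cong; cong₂; subst)

-- The hub and the n spokes are pairwise adjacent or incident, so at least n + 1
-- colors are needed.  For n ≥ 12 they suffice: color the hub n and the spoke at rim
-- position p with p, and give the rim objects, read around the rim as
-- v₀ e₀ v₁ e₁ …, odd colors from a sequence that never repeats within distance two
-- and lags behind the rim position.  Every spoke at an even position is then alone
-- in its color class; these classes dominate the hub and every rim edge (each has
-- an even endpoint), and the class of the hub dominates all other objects.  For
-- 8 ≤ n ≤ 11, and with n + 2 colors for 3 ≤ n ≤ 7, explicit colorings are checked
-- by a decision procedure.  That n + 1 colors fail for n ≤ 7 is an exhaustive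
-- search: after renaming, the hub and spokes carry the colors 0, …, n, only the
-- rim is left to color, and a branch is cut as soon as some object can no longer
-- be dominated.

-- Deciding properties of total colorings of a finite graph

module _ {G : Graph} where
  open Graph G using (N; adj)

  edg-cong : ∀ {u v u′ v′ lt q lt′ q′} → u ≡ u′ → v ≡ v′ → edg {G} u v lt q ≡ edg u′ v′ lt′ q′
  edg-cong {lt = lt} {q} {lt′} {q′} refl refl =
    cong₂ (edg _ _) (Finₚ.<-irrelevant lt lt′) (T-irrelevant q q′)

  _≟ᴼ_ : DecidableEquality (Object G)
  vtx u ≟ᴼ vtx v = map′ (cong vtx) (λ { refl → refl }) (u Finₚ.≟ v)
  vtx _ ≟ᴼ edg _ _ _ _ = no λ ()
  edg _ _ _ _ ≟ᴼ vtx _ = no λ ()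
  edg u v _ _ ≟ᴼ edg u′ v′ _ _ with u Finₚ.≟ u′ | v Finₚ.≟ v′
  ... | yes refl | yes refl = yes (edg-cong refl refl)
  ... | no u≢u′  | _        = no λ { refl → u≢u′ refl }
  ... | _        | no v≢v′  = no λ { refl → v≢v′ refl }

  related? : (x y : Object G) → Dec (Related G x y)
  related? (vtx u) (vtx v) = T? (adj u v)
  related? (vtx w) (edg u v _ _) = (w Finₚ.≟ u) ⊎-dec (w Finₚ.≟ v)
  related? (edg u v _ _) (vtx w) = (w Finₚ.≟ u) ⊎-dec (w Finₚ.≟ v)
  related? e@(edg u v _ _) f@(edg u′ v′ _ _) =
    ¬? (e ≟ᴼ f) ×-dec ((u Finₚ.≟ u′) ⊎-dec (u Finₚ.≟ v′) ⊎-dec (v Finₚ.≟ u′) ⊎-dec (v Finₚ.≟ v′))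

  related-sym : ∀ {x y : Object G} → Related G x y → Related G y x
  related-sym {vtx u} {vtx v} r = subst T (Graph.sym G u v) r
  related-sym {vtx _} {edg _ _ _ _} r = r
  related-sym {edg _ _ _ _} {vtx _} r = r
  related-sym {edg _ _ _ _} {edg _ _ _ _} (x≢y , shared) = x≢y ∘ sym , swap shared
    where
    swap : ∀ {u v u′ v′ : Fin N} → u ≡ u′ ⊎ u ≡ v′ ⊎ v ≡ u′ ⊎ v ≡ v′ → u′ ≡ u ⊎ u′ ≡ v ⊎ v′ ≡ u ⊎ v′ ≡ v
    swap (inj₁ e) = inj₁ (sym e)
    swap (inj₂ (inj₁ e)) = inj₂ (inj₂ (inj₁ (sym e)))
    swap (inj₂ (inj₂ (inj₁ e))) = inj₂ (inj₁ (sym e))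
    swap (inj₂ (inj₂ (inj₂ e))) = inj₂ (inj₂ (inj₂ (sym e)))

  edge? : Fin N → Fin N → List (Object G)
  edge? u v with u Finₚ.<? v | T? (adj u v)
  ... | yes lt | yes q = [ edg u v lt q ]
  ... | _      | _     = []

  ∈-edge? : ∀ {u v} (lt : u Fin.< v) (q : T (adj u v)) → edg u v lt q ∈ₗ edge? u v
  ∈-edge? {u} {v} lt q with u Finₚ.<? v | T? (adj u v)
  ... | yes _  | yes _ = here (edg-cong refl refl)
  ... | no ¬lt | _     = contradiction lt ¬lt
  ... | yes _  | no ¬q = contradiction q ¬q

module _ (G : Graph) where
  open Graph G using (N)

  objects : List (Object G)
  objects = concatMap (λ u → vtx u ∷ concatMap (edge? u) (allFin N)) (allFin N)

  ∈-objects : ∀ o → o ∈ₗ objects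
  ∈-objects (vtx u) = ∈-concatMap⁺ _ (lose (∈-allFin u) (here refl))
  ∈-objects (edg u v lt q) =
    ∈-concatMap⁺ _ (lose (∈-allFin u) (there (∈-concatMap⁺ _ (lose (∈-allFin v) (∈-edge? lt q)))))

  ∀-object? : ∀ {P : Object G → Set} → (∀ o → Dec (P o)) → Dec (∀ o → P o)
  ∀-object? P? = map′ (λ all o → All.lookup all (∈-objects o)) (λ all → All.tabulate λ {o} _ → all o)
                      (All.all? P? objects)

  ∃-object? : ∀ {P : Object G → Set} → (∀ o → Dec (P o)) → Dec (∃ P)
  ∃-object? P? = map′ (λ any → let o , _ , p = find any in o , p) (λ (o , p) → lose (∈-objects o) p)
                      (Any.any? P? objects)

  Proper : (k : ℕ) → (Object G → Fin k) → Set
  Proper k c = ∀ x y → Related G x y → ¬ c x ≡ c y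

  isTDTColoring? : ∀ k c → Dec (IsTDTColoring G k c)
  isTDTColoring? k c = (surjective? ×-dec proper?) ×-dec dominating?
    where
    surjective? : Dec (Surjective _≡_ _≡_ c)
    surjective? = map′ strictlySurjective⇒surjective surjective⇒strictlySurjective
                       (Finₚ.all? λ i → ∃-object? λ o → c o Finₚ.≟ i)
    proper? : Dec (Proper k c)
    proper? = ∀-object? λ x → ∀-object? λ y → related? x y →-dec ¬? (c x Finₚ.≟ c y)
    dominating? : Dec (IsTotalDominator G k c)
    dominating? = ∀-object? λ x → Finₚ.any? λ i → ∀-object? λ y → (c y Finₚ.≟ i) →-dec related? x y

module _ {G : Graph} {k : ℕ} (c : Object G → ℕ) (c<k : ∀ o → c o < k) where
  finColoring : Object G → Fin k
  finColoring o = fromℕ< (c<k o)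

  finColoring-isTDT : (∀ (i : Fin k) → ∃ λ o → c o ≡ toℕ i) →
                      (∀ x y → Related G x y → c x ≢ c y) →
                      (∀ x → ∃ λ (i : Fin k) → ∀ y → c y ≡ toℕ i → Related G x y) →
                      IsTDTColoring G k finColoring
  finColoring-isTDT onto proper dominating = (surjective , proper′) , dominating′
    where
    class : ∀ {o i} → finColoring o ≡ i → c o ≡ toℕ i
    class {o} refl = sym (toℕ-fromℕ< (c<k o))
    surjective : Surjective _≡_ _≡_ finColoring
    surjective = strictlySurjective⇒surjective λ i →
      let o , co≡i = onto i in o , toℕ-injective (trans (toℕ-fromℕ< (c<k o)) co≡i)
    proper′ : Proper G k finColoring
    proper′ x y r same = proper x y r (trans (class refl) (sym (class (sym same))))
    dominating′ : IsTotalDominator G k finColoring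
    dominating′ x = let i , dom = dominating x in i , λ y cy≡i → dom y (class cy≡i)

certify : ∀ {G} k (c : Object G → ℕ)
          {c<k : True (∀-object? G λ o → c o ℕₚ.<? k)}
          {tdt : True (isTDTColoring? G k (finColoring c (toWitness c<k)))} →
          HasTDTColoring G k
certify k c {c<k} {tdt} = finColoring c (toWitness c<k) , toWitness tdt

-- Cliques of objects and renaming of colors

injective⇒surjective : ∀ {n} {f : Fin n → Fin n} → Injective _≡_ _≡_ f → ∀ y → ∃ λ x → f x ≡ y
injective⇒surjective {suc n} {f} f-inj y with Finₚ.any? (λ x → f x Finₚ.≟ y)
... | yes hit = hit
... | no miss = contradiction (injective⇒≤ g-inj) ℕₚ.1+n≰n
  where
  y≢f : ∀ x → y ≢ f x
  y≢f x y≡fx = miss (x , sym y≡fx)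
  g-inj : Injective _≡_ _≡_ (λ x → punchOut (y≢f x))
  g-inj {a} {b} = f-inj ∘ punchOut-injective (y≢f a) (y≢f b)

module _ {G : Graph} where
  IsClique : ∀ {m} → (Fin m → Object G) → Set
  IsClique f = ∀ {i j} → i ≢ j → Related G (f i) (f j)

  module _ {k} {c : Object G → Fin k} (proper : Proper G k c) where
    clique-injective : ∀ {m} {f : Fin m → Object G} → IsClique f → Injective _≡_ _≡_ (c ∘ f)
    clique-injective {f = f} clique {i} {j} same with i Finₚ.≟ j
    ... | yes i≡j = i≡j
    ... | no i≢j = contradiction same (proper (f i) (f j) (clique i≢j))

    clique≤colors : ∀ {m} {f : Fin m → Object G} → IsClique f → m ≤ k
    clique≤colors {f = f} clique = injective⇒≤ (clique-injective {f = f} clique)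

    rename-proper : ∀ {σ : Fin k → Fin k} → Injective _≡_ _≡_ σ → Proper G k (σ ∘ c)
    rename-proper σ-inj x y r = proper x y r ∘ σ-inj

    rename-dominator : ∀ {σ : Fin k → Fin k} → Injective _≡_ _≡_ σ →
                       IsTotalDominator G k c → IsTotalDominator G k (σ ∘ c)
    rename-dominator {σ} σ-inj dominating x =
      let i , dom = dominating x in σ i , λ y σcy≡σi → dom y (σ-inj σcy≡σi)

    normalise : {f : Fin k → Object G} → IsClique f → IsTotalDominator G k c →
                ∃ λ c′ → Proper G k c′ × IsTotalDominator G k c′ × (∀ j → c′ (f j) ≡ j)
    normalise {f} clique dominating =
      σ ∘ c , rename-proper σ-inj , rename-dominator σ-inj dominating , σ∘c∘f≡id
      where
      cf-inj = clique-injective clique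
      σ : Fin k → Fin k
      σ i = proj₁ (injective⇒surjective cf-inj i)
      c∘f∘σ≡id : ∀ i → c (f (σ i)) ≡ i
      c∘f∘σ≡id i = proj₂ (injective⇒surjective cf-inj i)
      σ-inj : Injective _≡_ _≡_ σ
      σ-inj {i} {j} σi≡σj = trans (sym (c∘f∘σ≡id i)) (trans (cong (c ∘ f) σi≡σj) (c∘f∘σ≡id j))
      σ∘c∘f≡id : ∀ j → σ (c (f j)) ≡ j
      σ∘c∘f≡id j = cf-inj (c∘f∘σ≡id (c (f j)))

-- Exhaustive search for total dominator total colorings

-- A candidate set records the colors whose class may still dominate its object.
-- Coloring o with i removes i from the candidates of every object unrelated to o,
-- and a branch is abandoned as soon as a candidate set becomes empty.
module Search (G : Graph) (k : ℕ) where
  Assignment Candidates : Set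
  Assignment = List (Object G × Fin k)
  Candidates = List (Object G × Subset k)

  clashes : Assignment → Object G → Fin k → Bool
  clashes σ o i = any (λ (y , j) → ⌊ j Finₚ.≟ i ⌋ ∧ ⌊ related? o y ⌋) σ

  narrow : Object G → Fin k → Object G × Subset k → Object G × Subset k
  narrow o i (x , S) = x , (if ⌊ related? x o ⌋ then S else S - i)

  exhausted : Candidates → Bool
  exhausted = any λ (x , S) → not ⌊ nonempty? S ⌋

  extendable : Assignment → Candidates → List (Object G × List (Fin k)) → Bool
  extendable σ cs [] = true
  extendable σ cs ((o , is) ∷ os) = any extend is
    where
    extend : Fin k → Bool
    extend i = let cs′ = map (narrow o i) cs in
      not (clashes σ o i) ∧ not (exhausted cs′) ∧ extendable ((o , i) ∷ σ) cs′ os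

  colorable : (Object G → List (Fin k)) → Bool
  colorable allowed = extendable [] (map (_, ⊤) (objects G)) (map (λ o → o , allowed o) (objects G))

  module Completeness {c : Object G → Fin k} (proper : Proper G k c)
                      (dominating : IsTotalDominator G k c) where
    Dominates : Object G → Fin k → Set
    Dominates x i = ∀ y → c y ≡ i → Related G x y

    Agrees : Assignment → Set
    Agrees = All λ (y , j) → c y ≡ j

    Complete : Object G × Subset k → Set
    Complete (x , S) = ∀ i → Dominates x i → i ∈ S

    ¬clashes : ∀ {σ} o → Agrees σ → ¬ T (clashes σ o (c o))
    ¬clashes {σ} o agrees = Allₚ.All¬⇒¬Any (All.map no-clash agrees) ∘ any⁻ _ σ
      where
      no-clash : ∀ {(y , j) : Object G × Fin k} → c y ≡ j → ¬ T (⌊ j Finₚ.≟ c o ⌋ ∧ ⌊ related? o y ⌋)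
      no-clash {y , j} refl t with j Finₚ.≟ c o | related? o y
      ... | yes same | yes r = proper o y r (sym same)

    narrow-complete : ∀ o {xS} → Complete xS → Complete (narrow o (c o) xS)
    narrow-complete o {x , S} complete i dom with related? x o
    ... | yes _ = complete i dom
    ... | no ¬r = x∈p∧x≢y⇒x∈p-y (complete i dom) λ { refl → ¬r (dom o refl) }

    ¬exhausted : ∀ {cs} → All Complete cs → ¬ T (exhausted cs)
    ¬exhausted {cs} complete = Allₚ.All¬⇒¬Any (All.map (λ {xS} → nonempty {xS}) complete) ∘ any⁻ _ cs
      where
      nonempty : ∀ {xS} → Complete xS → ¬ T (not ⌊ nonempty? (proj₂ xS) ⌋)
      nonempty {x , S} complete t with nonempty? S
      ... | no empty = let i , dom = dominating x in empty (i , complete i dom)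

    extendable-complete : ∀ {σ cs} os → Agrees σ → All Complete cs → All (λ (o , is) → c o ∈ₗ is) os →
                          T (extendable σ cs os)
    extendable-complete [] _ _ _ = _
    extendable-complete ((o , is) ∷ os) agrees complete (allowed ∷ rest) =
      any⁺ _ (lose allowed (∧-intro (not-intro (¬clashes o agrees))
                                    (∧-intro (not-intro (¬exhausted complete′))
                                             (extendable-complete os (refl ∷ agrees) complete′ rest))))
      where
      complete′ = Allₚ.map⁺ (All.map (λ {xS} → narrow-complete o {xS}) complete)
      ∧-intro : ∀ {a b} → T a → T b → T (a ∧ b)
      ∧-intro {true} _ tb = tb
      not-intro : ∀ {b} → ¬ T b → T (not b)
      not-intro {false} _ = _
      not-intro {true} ¬t = ¬t _

    colorable-complete : ∀ allowed → (∀ o → c o ∈ₗ allowed o) → T (colorable allowed)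
    colorable-complete allowed c∈allowed =
      extendable-complete (map (λ o → o , allowed o) (objects G)) []
        (Allₚ.map⁺ (All.universal (λ _ _ _ → ∈⊤) (objects G)))
        (Allₚ.map⁺ (All.universal c∈allowed (objects G)))

-- The hub and the spokes

module _ {n : ℕ} where
  star : Fin (suc n) → Object (Wheel n)
  star zero = vtx zero
  star (suc p) = edg zero (suc p) (s≤s z≤n) _

  star-clique : IsClique star
  star-clique {zero} {zero} 0≢0 = 0≢0 refl
  star-clique {zero} {suc _} _ = inj₁ refl
  star-clique {suc _} {zero} _ = inj₁ refl
  star-clique {suc _} {suc _} p≢q = (λ { refl → p≢q refl }) , inj₁ refl

wheel-colors≥ : ∀ {n k} → HasTDTColoring (Wheel n) k → suc n ≤ k
wheel-colors≥ (_ , (_ , proper) , _) = clique≤colors proper {f = star} star-clique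

module _ (n : ℕ) where
  open Search (Wheel n) (suc n)

  starColors : Object (Wheel n) → List (Fin (suc n))
  starColors (vtx zero) = [ zero ]
  starColors (edg zero (suc p) _ _) = [ suc p ]
  starColors _ = allFin (suc n)

  starColors-allows : ∀ {c : Object (Wheel n) → Fin (suc n)} → (∀ j → c (star j) ≡ j) →
                      ∀ o → c o ∈ₗ starColors o
  starColors-allows c∘star≡id (vtx zero) = here (c∘star≡id zero)
  starColors-allows c∘star≡id (vtx (suc _)) = ∈-allFin _
  starColors-allows {c} c∘star≡id (edg zero (suc p) _ _) =
    here (trans (cong c (edg-cong refl refl)) (c∘star≡id (suc p)))
  starColors-allows c∘star≡id (edg (suc _) _ _ _) = ∈-allFin _

  no-wheel-coloring : colorable starColors ≡ false → ¬ HasTDTColoring (Wheel n) (suc n)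
  no-wheel-coloring fails (c , (_ , proper) , dominating)
    with c′ , proper′ , dominating′ , c′∘star≡id ← normalise proper {f = star} star-clique dominating
    = subst T fails
        (Completeness.colorable-complete proper′ dominating′ starColors (starColors-allows c′∘star≡id))

-- Wheel colorings determined by a rim sequence

-- Rim position p is the vertex suc p.  The rim edge leaving position p has position
-- p; in particular the closing edge, stored with endpoints 0 < n - 1, has position n - 1.
edgePosition : ℕ → ℕ → ℕ
edgePosition a b = if does (b ≟ suc a) then a else b

wheelColoring : (n hub : ℕ) (rim : ℕ → ℕ) → Object (Wheel n) → ℕ
wheelColoring n h rim (vtx zero) = h
wheelColoring n h rim (vtx (suc p)) = rim (2 * toℕ p)
wheelColoring n h rim (edg zero (suc p) _ _) = toℕ p
wheelColoring n h rim (edg (suc a) (suc b) _ _) = rim (1 + 2 * edgePosition (toℕ a) (toℕ b))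
wheelColoring n h rim (edg zero zero () _)
wheelColoring n h rim (edg (suc _) zero () _)

data RimStep (n : ℕ) : ℕ → ℕ → Set where
  inner   : ∀ {p} → RimStep n p (suc p)
  closing : ∀ {p} → suc p ≡ n → RimStep n p 0

data Endpoint (n e : ℕ) : ℕ → Set where
  tail : Endpoint n e e
  head : ∀ {w} → RimStep n e w → Endpoint n e w

data RimEdge (n : ℕ) : ℕ → ℕ → ℕ → Set where
  inner   : ∀ {a} → RimEdge n a (suc a) a
  closing : ∀ {b} → suc b ≡ n → RimEdge n 0 b b

-- The rim objects are read cyclically as v₀ e₀ v₁ e₁ … v₍ₙ₋₁₎ e₍ₙ₋₁₎, the vertex at
-- position p having index 2p and the edge leaving it index 2p + 1.  Related rim
-- objects are one or two steps apart in this order, in one direction or the other.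
data Near (n : ℕ) : ℕ → ℕ → Set where
  next₁ : ∀ {i} → Near n i (1 + i)
  next₂ : ∀ {i} → Near n i (2 + i)
  wrap-vertex : ∀ {p} → suc p ≡ n → Near n (2 * p) 0
  wrap-edge₁  : ∀ {p} → suc p ≡ n → Near n (1 + 2 * p) 0
  wrap-edge₂  : ∀ {p} → suc p ≡ n → Near n (1 + 2 * p) 1

module _ {n : ℕ} where
  arc⇒step : ∀ {a b} → T (⌊ b ≟ suc a ⌋ ∨ (⌊ suc a ≟ n ⌋ ∧ ⌊ b ≟ 0 ⌋)) → RimStep n a b
  arc⇒step {a} {b} t with b ≟ suc a | suc a ≟ n | b ≟ 0
  ... | yes refl | _ | _ = inner
  ... | no _ | yes 1+a≡n | yes refl = closing 1+a≡n

  rim-adjacent : ∀ {a b} → T (wadjℕ n (suc a) (suc b)) → RimStep n a b ⊎ RimStep n b a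
  rim-adjacent {a} {b} t with arcℕ n (suc a) (suc b) in ab | arcℕ n (suc b) (suc a) in ba
  ... | true  | _    = inj₁ (arc⇒step (subst T (sym ab) _))
  ... | false | true = inj₂ (arc⇒step (subst T (sym ba) _))

  edgePosition-inner : ∀ a → edgePosition a (suc a) ≡ a
  edgePosition-inner a = cong (if_then a else suc a) (dec-true (suc a ≟ suc a) refl)

  edgePosition-closing : ∀ {b} → b ≢ 1 → edgePosition 0 b ≡ b
  edgePosition-closing {b} b≢1 = cong (if_then 0 else b) (dec-false (b ≟ 1) b≢1)

  rimEdge : ∀ {a b} → 3 ≤ n → a < b → T (wadjℕ n (suc a) (suc b)) → RimEdge n a b (edgePosition a b)
  rimEdge {a} {b} 3≤n a<b t with rim-adjacent {a} {b} t
  ... | inj₁ inner = subst (RimEdge n a (suc a)) (sym (edgePosition-inner a)) inner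
  ... | inj₁ (closing _) = contradiction a<b λ ()
  ... | inj₂ inner = contradiction a<b (ℕₚ.<-asym (ℕₚ.n<1+n _))
  ... | inj₂ (closing 1+b≡n) = subst (RimEdge n 0 b) (sym (edgePosition-closing b≢1)) (closing 1+b≡n)
    where
    b≢1 : b ≢ 1
    b≢1 refl = contradiction (subst (3 ≤_) (sym 1+b≡n) 3≤n) λ { (s≤s (s≤s ())) }

odd≢even : ∀ {a b} → parity a ≡ 1ℙ → parity b ≡ 0ℙ → a ≢ b
odd≢even odd even a≡b = contradiction (trans (sym odd) (trans (cong parity a≡b) even)) λ ()

endpoints : ∀ {n a b e} → RimEdge n a b e → Endpoint n e a × Endpoint n e b
endpoints inner = tail , head inner
endpoints (closing 1+b≡n) = head (closing 1+b≡n) , tail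

rimEdge-unique : ∀ {n a b a′ b′ e} → RimEdge n a b e → RimEdge n a′ b′ e → b < n → b′ < n →
                 a ≡ a′ × b ≡ b′
rimEdge-unique inner inner _ _ = refl , refl
rimEdge-unique inner (closing refl) 1+e<n _ = contradiction 1+e<n (ℕₚ.<-irrefl refl)
rimEdge-unique (closing refl) inner _ 1+e<n = contradiction 1+e<n (ℕₚ.<-irrefl refl)
rimEdge-unique (closing _) (closing _) _ _ = refl , refl

even-endpoint : ∀ {n a b e} → RimEdge n a b e → ∃ λ w → (w ≡ a ⊎ w ≡ b) × parity w ≡ 0ℙ
even-endpoint {a = a} inner with parity a in eq
... | 0ℙ = a , inj₁ refl , eq
... | 1ℙ = suc a , inj₂ refl , trans (sym (suc-homo-⁻¹ (suc a))) (cong _⁻¹ eq)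
even-endpoint (closing _) = 0 , inj₁ refl , refl

step-injective : ∀ {n e f w} → RimStep n e w → RimStep n f w → e ≡ f
step-injective inner inner = refl
step-injective (closing 1+e≡n) (closing 1+f≡n) = ℕₚ.suc-injective (trans 1+e≡n (sym 1+f≡n))

step-vertices : ∀ {n p q} → RimStep n p q → Near n (2 * p) (2 * q)
step-vertices {p = p} inner = subst (Near _ (2 * p)) (sym (ℕₚ.*-suc 2 p)) next₂
step-vertices (closing 1+p≡n) = wrap-vertex 1+p≡n

step-edges : ∀ {n e f} → RimStep n e f → Near n (1 + 2 * e) (1 + 2 * f)
step-edges {e = e} inner = subst (Near _ (1 + 2 * e)) (cong suc (sym (ℕₚ.*-suc 2 e))) next₂
step-edges (closing 1+e≡n) = wrap-edge₂ 1+e≡n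

endpoint-near : ∀ {n e w} → Endpoint n e w → Near n (2 * w) (1 + 2 * e) ⊎ Near n (1 + 2 * e) (2 * w)
endpoint-near tail = inj₁ next₁
endpoint-near {e = e} (head inner) = inj₂ (subst (Near _ (1 + 2 * e)) (sym (ℕₚ.*-suc 2 e)) next₁)
endpoint-near (head (closing 1+e≡n)) = inj₂ (wrap-edge₁ 1+e≡n)

shared-endpoint : ∀ {n e f w} → Endpoint n e w → Endpoint n f w →
                  e ≡ f ⊎ Near n (1 + 2 * e) (1 + 2 * f) ⊎ Near n (1 + 2 * f) (1 + 2 * e)
shared-endpoint tail tail = inj₁ refl
shared-endpoint tail (head step) = inj₂ (inj₂ (step-edges step))
shared-endpoint (head step) tail = inj₂ (inj₁ (step-edges step))
shared-endpoint (head step) (head step′) = inj₁ (step-injective step step′)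

record IsRimSequence (n : ℕ) (s : ℕ → ℕ) : Set where
  field
    near-apart   : ∀ {i j} → Near n i j → s i ≢ s j
    vertex-apart : ∀ p → s (2 * p) ≢ p
    edge-apart   : ∀ {e w} → Endpoint n e w → s (1 + 2 * e) ≢ w
    odd          : ∀ j → parity (s j) ≡ 1ℙ
    below        : ∀ j → j < 2 * n → s j < n

data WheelObject {n : ℕ} : Object (Wheel n) → Set where
  hub        : WheelObject (vtx zero)
  rim-vertex : ∀ p → WheelObject (vtx (suc p))
  spoke      : ∀ p {lt q} → WheelObject (edg zero (suc p) lt q)
  rim-edge   : ∀ a b lt q → WheelObject (edg (suc a) (suc b) lt q)

wheelObject : ∀ {n} (o : Object (Wheel n)) → WheelObject o
wheelObject (vtx zero) = hub
wheelObject (vtx (suc p)) = rim-vertex p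
wheelObject (edg zero (suc p) _ _) = spoke p
wheelObject (edg (suc a) (suc b) lt q) = rim-edge a b lt q
wheelObject (edg zero zero () _)
wheelObject (edg (suc _) zero () _)

suc-toℕ : ∀ {m} {a b : Fin m} → Fin.suc a ≡ suc b → toℕ a ≡ toℕ b
suc-toℕ = cong toℕ ∘ Finₚ.suc-injective

module RimColoring {n s} (3≤n : 3 ≤ n) (rim : IsRimSequence n s) where
  open IsRimSequence rim

  color : Object (Wheel n) → ℕ
  color = wheelColoring n n s

  position : Fin n → Fin n → ℕ
  position a b = edgePosition (toℕ a) (toℕ b)

  shape : ∀ {a b : Fin n} (lt : Fin.suc a Fin.< suc b) (q : T (wadjℕ n (suc (toℕ a)) (suc (toℕ b)))) →
          RimEdge n (toℕ a) (toℕ b) (position a b)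
  shape lt q = rimEdge 3≤n (s≤s⁻¹ lt) q

  incident : ∀ {a b e w} → RimEdge n a b e → w ≡ a ⊎ w ≡ b → Endpoint n e w
  incident r (inj₁ refl) = proj₁ (endpoints r)
  incident r (inj₂ refl) = proj₂ (endpoints r)

  apart : ∀ {i j} → Near n i j ⊎ Near n j i → s i ≢ s j
  apart (inj₁ near) = near-apart near
  apart (inj₂ near) = near-apart near ∘ sym

  vertex-color<n : ∀ (p : Fin n) → s (2 * toℕ p) < n
  vertex-color<n p = below _ (ℕₚ.*-monoʳ-< 2 (toℕ<n p))

  edge-color<n : ∀ (a b : Fin n) → s (1 + 2 * position a b) < n
  edge-color<n a b = below _ (subst (_≤ 2 * n) (ℕₚ.*-suc 2 _) (ℕₚ.*-monoʳ-≤ 2 position<n))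
    where
    position<n : position a b < n
    position<n with does (toℕ b ≟ suc (toℕ a))
    ... | true = toℕ<n a
    ... | false = toℕ<n b

  color<1+n : ∀ o → color o < suc n
  color<1+n o with wheelObject o
  ... | hub = ℕₚ.n<1+n n
  ... | rim-vertex p = ℕₚ.m<n⇒m<1+n (vertex-color<n p)
  ... | spoke p = ℕₚ.m<n⇒m<1+n (toℕ<n p)
  ... | rim-edge a b _ _ = ℕₚ.m<n⇒m<1+n (edge-color<n a b)

  vertex≢edge : ∀ {w a b e} → RimEdge n a b e → w ≡ a ⊎ w ≡ b → s (2 * w) ≢ s (1 + 2 * e)
  vertex≢edge r w∈ab = apart (endpoint-near (incident r w∈ab))

  spoke≢edge : ∀ {p a b e} → RimEdge n a b e → p ≡ a ⊎ p ≡ b → p ≢ s (1 + 2 * e)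
  spoke≢edge r p∈ab = edge-apart (incident r p∈ab) ∘ sym

  edge≢edge : ∀ {a b e a′ b′ e′ w} → RimEdge n a b e → RimEdge n a′ b′ e′ → b < n → b′ < n →
              ¬ (a ≡ a′ × b ≡ b′) → w ≡ a ⊎ w ≡ b → w ≡ a′ ⊎ w ≡ b′ → s (1 + 2 * e) ≢ s (1 + 2 * e′)
  edge≢edge r r′ b<n b′<n distinct w∈ab w∈a′b′
    with shared-endpoint (incident r w∈ab) (incident r′ w∈a′b′)
  ... | inj₁ refl = λ _ → distinct (rimEdge-unique r r′ b<n b′<n)
  ... | inj₂ near = apart near

  vertex≢spoke : ∀ {w p : Fin n} → Fin.suc w ≡ zero ⊎ suc w ≡ suc p → s (2 * toℕ w) ≢ toℕ p
  vertex≢spoke (inj₁ ())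
  vertex≢spoke (inj₂ w≡p) = vertex-apart _ ∘ λ e → trans e (sym (suc-toℕ w≡p))

  map-toℕ : ∀ {w a b : Fin n} → Fin.suc w ≡ suc a ⊎ suc w ≡ suc b → toℕ w ≡ toℕ a ⊎ toℕ w ≡ toℕ b
  map-toℕ = Sum.map suc-toℕ suc-toℕ

  spoke-incidence : ∀ {p a b : Fin n} →
                    zero ≡ Fin.suc a ⊎ zero ≡ Fin.suc b ⊎ suc p ≡ suc a ⊎ suc p ≡ suc b →
                    toℕ p ≡ toℕ a ⊎ toℕ p ≡ toℕ b
  spoke-incidence (inj₂ (inj₂ p∈ab)) = map-toℕ p∈ab

  shared-vertex : ∀ {a b a′ b′ : Fin n} →
                  Fin.suc a ≡ suc a′ ⊎ suc a ≡ suc b′ ⊎ suc b ≡ suc a′ ⊎ suc b ≡ suc b′ →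
                  ∃ λ w → (w ≡ toℕ a ⊎ w ≡ toℕ b) × (w ≡ toℕ a′ ⊎ w ≡ toℕ b′)
  shared-vertex (inj₁ e) = _ , inj₁ refl , inj₁ (suc-toℕ e)
  shared-vertex (inj₂ (inj₁ e)) = _ , inj₁ refl , inj₂ (suc-toℕ e)
  shared-vertex (inj₂ (inj₂ (inj₁ e))) = _ , inj₂ refl , inj₁ (suc-toℕ e)
  shared-vertex (inj₂ (inj₂ (inj₂ e))) = _ , inj₂ refl , inj₂ (suc-toℕ e)

  distinct-endpoints : ∀ {a b a′ b′ : Fin n} {lt q lt′ q′} →
                       edg {Wheel n} (suc a) (suc b) lt q ≢ edg (suc a′) (suc b′) lt′ q′ →
                       ¬ (toℕ a ≡ toℕ a′ × toℕ b ≡ toℕ b′)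
  distinct-endpoints ne (a≡a′ , b≡b′) =
    ne (edg-cong (cong suc (toℕ-injective a≡a′)) (cong suc (toℕ-injective b≡b′)))

  proper : ∀ x y → Related (Wheel n) x y → color x ≢ color y
  proper x y r with wheelObject x | wheelObject y
  ... | hub | hub = λ _ → r
  ... | hub | rim-vertex p = ℕₚ.>⇒≢ (vertex-color<n p)
  ... | hub | spoke p = ℕₚ.>⇒≢ (toℕ<n p)
  ... | hub | rim-edge _ _ _ _ = contradiction r λ { (inj₁ ()) ; (inj₂ ()) }
  ... | rim-vertex p | hub = ℕₚ.<⇒≢ (vertex-color<n p)
  ... | rim-vertex p | rim-vertex q =
    apart (Sum.map step-vertices step-vertices (rim-adjacent {a = toℕ p} {toℕ q} r))
  ... | rim-vertex _ | spoke _ = vertex≢spoke r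
  ... | rim-vertex _ | rim-edge _ _ lt q = vertex≢edge (shape lt q) (map-toℕ r)
  ... | spoke p | hub = ℕₚ.<⇒≢ (toℕ<n p)
  ... | spoke _ | rim-vertex _ = vertex≢spoke r ∘ sym
  ... | spoke _ | spoke _ = proj₁ r ∘ λ p≡q → edg-cong refl (cong suc (toℕ-injective p≡q))
  ... | spoke _ | rim-edge _ _ lt q = spoke≢edge (shape lt q) (spoke-incidence (proj₂ r))
  ... | rim-edge _ _ _ _ | hub = contradiction r λ { (inj₁ ()) ; (inj₂ ()) }
  ... | rim-edge _ _ lt q | rim-vertex _ = vertex≢edge (shape lt q) (map-toℕ r) ∘ sym
  ... | rim-edge _ _ lt q | spoke _ =
    spoke≢edge (shape lt q) (spoke-incidence (proj₂ (related-sym {x = x} {y} r))) ∘ sym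
  ... | rim-edge _ b lt q | rim-edge _ b′ lt′ q′ =
    let _ , w∈ab , w∈a′b′ = shared-vertex (proj₂ r) in
    edge≢edge (shape lt q) (shape lt′ q′) (toℕ<n b) (toℕ<n b′) (distinct-endpoints (proj₁ r)) w∈ab w∈a′b′

  data SpokeAt (w : ℕ) : Object (Wheel n) → Set where
    spokeAt : ∀ {p lt q} → toℕ p ≡ w → SpokeAt w (edg zero (suc p) lt q)

  even-class : ∀ {w} y → parity w ≡ 0ℙ → w < n → color y ≡ w → SpokeAt w y
  even-class y even w<n cy≡w with wheelObject y
  ... | hub = contradiction w<n (ℕₚ.<-irrefl (sym cy≡w))
  ... | rim-vertex _ = contradiction cy≡w (odd≢even (odd _) even)
  ... | spoke _ = spokeAt cy≡w
  ... | rim-edge _ _ _ _ = contradiction cy≡w (odd≢even (odd _) even)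

  hub-class : ∀ y → color y ≡ n → y ≡ vtx zero
  hub-class y cy≡n with wheelObject y
  ... | hub = refl
  ... | rim-vertex p = contradiction cy≡n (ℕₚ.<⇒≢ (vertex-color<n p))
  ... | spoke p = contradiction cy≡n (ℕₚ.<⇒≢ (toℕ<n p))
  ... | rim-edge a b _ _ = contradiction cy≡n (ℕₚ.<⇒≢ (edge-color<n a b))

  edge~spoke : ∀ {a b : Fin n} {lt q w y} → w ≡ toℕ a ⊎ w ≡ toℕ b → SpokeAt w y →
               Related (Wheel n) (edg (suc a) (suc b) lt q) y
  edge~spoke (inj₁ refl) (spokeAt p≡a) = (λ ()) , inj₂ (inj₁ (cong suc (toℕ-injective (sym p≡a))))
  edge~spoke (inj₂ refl) (spokeAt p≡b) = (λ ()) , inj₂ (inj₂ (inj₂ (cong suc (toℕ-injective (sym p≡b)))))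

  dominating : ∀ x → ∃ λ (i : Fin (suc n)) → ∀ y → color y ≡ toℕ i → Related (Wheel n) x y
  dominating x with wheelObject x
  ... | hub = zero , λ y cy≡0 → hub~spoke (even-class y refl (ℕₚ.<-≤-trans (s≤s z≤n) 3≤n) cy≡0)
    where
    hub~spoke : ∀ {y} → SpokeAt 0 y → Related (Wheel n) (vtx zero) y
    hub~spoke (spokeAt _) = inj₁ refl
  ... | rim-vertex p = fromℕ n , λ y cy≡n →
    subst (Related (Wheel n) x) (sym (hub-class y (trans cy≡n (toℕ-fromℕ n)))) _
  ... | spoke p = fromℕ n , λ y cy≡n →
    subst (Related (Wheel n) x) (sym (hub-class y (trans cy≡n (toℕ-fromℕ n)))) (inj₁ refl)
  ... | rim-edge a b lt q =
    let w , w∈ab , even = even-endpoint (shape lt q)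
        w<n = [ (λ w≡a → subst (_< n) (sym w≡a) (toℕ<n a))
              , (λ w≡b → subst (_< n) (sym w≡b) (toℕ<n b)) ]′ w∈ab
    in fromℕ< (ℕₚ.m<n⇒m<1+n w<n) , λ y cy≡w →
       edge~spoke w∈ab (even-class y even w<n (trans cy≡w (Finₚ.toℕ-fromℕ< _)))

  onto : ∀ (i : Fin (suc n)) → ∃ λ o → color o ≡ toℕ i
  onto i with toℕ i ℕₚ.<? n
  ... | yes i<n = edg zero (suc (fromℕ< i<n)) (s≤s z≤n) _ , Finₚ.toℕ-fromℕ< i<n
  ... | no i≮n = vtx zero , ℕₚ.≤-antisym (ℕₚ.≮⇒≥ i≮n) (s≤s⁻¹ (toℕ<n i))

  rim-coloring : HasTDTColoring (Wheel n) (suc n)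
  rim-coloring = finColoring color color<1+n , finColoring-isTDT color color<1+n onto proper dominating

-- The rim sequence for n ≥ 12

-- From index 12 on, the colors run in blocks c, c + 2, c + 4, c with c growing by 2
-- from one block to the next.  They lag behind the rim position, so they avoid the
-- spokes at the object's endpoints and stay below n; the first twelve entries are
-- chosen by hand.
pattern 4+_ k = suc (suc (suc (suc k)))
pattern 12+_ k = 4+ 4+ 4+ k

block : ℕ → ℕ
block 0 = 1
block 1 = 3
block 2 = 5
block 3 = 1
block (4+ k) = 2 + block k

wheelRim : ℕ → ℕ
wheelRim 0 = 1
wheelRim 1 = 3
wheelRim 2 = 5
wheelRim 3 = 7
wheelRim 4 = 1
wheelRim 5 = 5
wheelRim 6 = 7
wheelRim 7 = 1
wheelRim 8 = 3
wheelRim 9 = 7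
wheelRim 10 = 9
wheelRim 11 = 11
wheelRim (12+ k) = block k

block-apart₁ : ∀ k → block k ≢ block (1 + k)
block-apart₁ 0 ()
block-apart₁ 1 ()
block-apart₁ 2 ()
block-apart₁ 3 ()
block-apart₁ (4+ k) = block-apart₁ k ∘ ℕₚ.+-cancelˡ-≡ 2 _ _

block-apart₂ : ∀ k → block k ≢ block (2 + k)
block-apart₂ 0 ()
block-apart₂ 1 ()
block-apart₂ 2 ()
block-apart₂ 3 ()
block-apart₂ (4+ k) = block-apart₂ k ∘ ℕₚ.+-cancelˡ-≡ 2 _ _

block-odd : ∀ k → parity (block k) ≡ 1ℙ
block-odd 0 = refl
block-odd 1 = refl
block-odd 2 = refl
block-odd 3 = refl
block-odd (4+ k) = block-odd k

block-below : ∀ k → 4 + 2 * block k ≤ 12 + k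
block-below 0 = ℕₚ.≤ᵇ⇒≤ _ _ _
block-below 1 = ℕₚ.≤ᵇ⇒≤ _ _ _
block-below 2 = ℕₚ.≤ᵇ⇒≤ _ _ _
block-below 3 = ℕₚ.≤ᵇ⇒≤ _ _ _
block-below (4+ k) =
  subst (_≤ 16 + k) (cong (4 +_) (sym (ℕₚ.*-distribˡ-+ 2 2 (block k)))) (ℕₚ.+-monoʳ-≤ 4 (block-below k))

block-large : ∀ k → 3 < block (8 + k)
block-large 0 = ℕₚ.≤ᵇ⇒≤ _ _ _
block-large 1 = ℕₚ.≤ᵇ⇒≤ _ _ _
block-large 2 = ℕₚ.≤ᵇ⇒≤ _ _ _
block-large 3 = ℕₚ.≤ᵇ⇒≤ _ _ _
block-large (4+ k) = ℕₚ.m≤n⇒m≤o+n 2 (block-large k)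

rim-apart₁ : ∀ j → wheelRim j ≢ wheelRim (1 + j)
rim-apart₁ 0 ()
rim-apart₁ 1 ()
rim-apart₁ 2 ()
rim-apart₁ 3 ()
rim-apart₁ 4 ()
rim-apart₁ 5 ()
rim-apart₁ 6 ()
rim-apart₁ 7 ()
rim-apart₁ 8 ()
rim-apart₁ 9 ()
rim-apart₁ 10 ()
rim-apart₁ 11 ()
rim-apart₁ (12+ k) = block-apart₁ k

rim-apart₂ : ∀ j → wheelRim j ≢ wheelRim (2 + j)
rim-apart₂ 0 ()
rim-apart₂ 1 ()
rim-apart₂ 2 ()
rim-apart₂ 3 ()
rim-apart₂ 4 ()
rim-apart₂ 5 ()
rim-apart₂ 6 ()
rim-apart₂ 7 ()
rim-apart₂ 8 ()
rim-apart₂ 9 ()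
rim-apart₂ 10 ()
rim-apart₂ 11 ()
rim-apart₂ (12+ k) = block-apart₂ k

rim-odd : ∀ j → parity (wheelRim j) ≡ 1ℙ
rim-odd 0 = refl
rim-odd 1 = refl
rim-odd 2 = refl
rim-odd 3 = refl
rim-odd 4 = refl
rim-odd 5 = refl
rim-odd 6 = refl
rim-odd 7 = refl
rim-odd 8 = refl
rim-odd 9 = refl
rim-odd 10 = refl
rim-odd 11 = refl
rim-odd (12+ k) = block-odd k

rim-small : ∀ j → wheelRim j ≤ 11 ⊎ 12 ≤ j
rim-small 0 = inj₁ (ℕₚ.≤ᵇ⇒≤ _ _ _)
rim-small 1 = inj₁ (ℕₚ.≤ᵇ⇒≤ _ _ _)
rim-small 2 = inj₁ (ℕₚ.≤ᵇ⇒≤ _ _ _)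
rim-small 3 = inj₁ (ℕₚ.≤ᵇ⇒≤ _ _ _)
rim-small 4 = inj₁ (ℕₚ.≤ᵇ⇒≤ _ _ _)
rim-small 5 = inj₁ (ℕₚ.≤ᵇ⇒≤ _ _ _)
rim-small 6 = inj₁ (ℕₚ.≤ᵇ⇒≤ _ _ _)
rim-small 7 = inj₁ (ℕₚ.≤ᵇ⇒≤ _ _ _)
rim-small 8 = inj₁ (ℕₚ.≤ᵇ⇒≤ _ _ _)
rim-small 9 = inj₁ (ℕₚ.≤ᵇ⇒≤ _ _ _)
rim-small 10 = inj₁ (ℕₚ.≤ᵇ⇒≤ _ _ _)
rim-small 11 = inj₁ (ℕₚ.≤ᵇ⇒≤ _ _ _)
rim-small (12+ k) = inj₂ (ℕₚ.m≤m+n 12 k)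

rim-below : ∀ {j} → 12 ≤ j → 4 + 2 * wheelRim j ≤ j
rim-below {j} 12≤j = subst (λ i → 4 + 2 * wheelRim i ≤ i) (ℕₚ.m+[n∸m]≡n 12≤j) (block-below (j ℕ.∸ 12))

rim-large : ∀ {j} → 20 ≤ j → 3 < wheelRim j
rim-large {j} 20≤j = subst (λ i → 3 < wheelRim i) (ℕₚ.m+[n∸m]≡n 20≤j) (block-large (j ℕ.∸ 20))

rim-late≢ : ∀ {j m} → 20 ≤ j → m ≤ 3 → wheelRim j ≢ m
rim-late≢ 20≤j m≤3 = ℕₚ.>⇒≢ (ℕₚ.≤-<-trans m≤3 (rim-large 20≤j))

rim<position : ∀ {j p} → 12 ≤ j → j ≤ 1 + 2 * p → wheelRim j < p
rim<position {j} {p} 12≤j j≤1+2p = ℕₚ.*-cancelˡ-< 2 _ _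
  (ℕₚ.≤-trans (ℕₚ.m≤n+m _ 2) (s≤s⁻¹ (ℕₚ.≤-trans (rim-below 12≤j) j≤1+2p)))

rim-vertex-apart : ∀ p → wheelRim (2 * p) ≢ p
rim-vertex-apart 0 ()
rim-vertex-apart 1 ()
rim-vertex-apart 2 ()
rim-vertex-apart 3 ()
rim-vertex-apart 4 ()
rim-vertex-apart 5 ()
rim-vertex-apart p@(4+ suc (suc q)) =
  ℕₚ.<⇒≢ (rim<position (ℕₚ.*-monoʳ-≤ 2 (ℕₚ.m≤m+n 6 q)) (ℕₚ.n≤1+n (2 * p)))

rim-edge-apart : ∀ e → (wheelRim (1 + 2 * e) ≢ e) × (wheelRim (1 + 2 * e) ≢ 1 + e)
rim-edge-apart 0 = (λ ()) , (λ ())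
rim-edge-apart 1 = (λ ()) , (λ ())
rim-edge-apart 2 = (λ ()) , (λ ())
rim-edge-apart 3 = (λ ()) , (λ ())
rim-edge-apart 4 = (λ ()) , (λ ())
rim-edge-apart 5 = (λ ()) , (λ ())
rim-edge-apart (4+ suc (suc q)) =
  let r<e = rim<position (ℕₚ.m≤n⇒m≤1+n (ℕₚ.*-monoʳ-≤ 2 (ℕₚ.m≤m+n 6 q))) ℕₚ.≤-refl
  in ℕₚ.<⇒≢ r<e , ℕₚ.<⇒≢ (ℕₚ.m<n⇒m<1+n r<e)

module _ {n} (12≤n : 12 ≤ n) where
  20≤last-index : ∀ {p} → suc p ≡ n → 20 ≤ 2 * p
  20≤last-index refl = ℕₚ.≤-trans (ℕₚ.≤ᵇ⇒≤ 20 22 _) (ℕₚ.*-monoʳ-≤ 2 (s≤s⁻¹ 12≤n))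

  rim-near-apart : ∀ {i j} → Near n i j → wheelRim i ≢ wheelRim j
  rim-near-apart {i} next₁ = rim-apart₁ i
  rim-near-apart {i} next₂ = rim-apart₂ i
  rim-near-apart (wrap-vertex 1+p≡n) = rim-late≢ (20≤last-index 1+p≡n) (s≤s z≤n)
  rim-near-apart (wrap-edge₁ 1+p≡n) = rim-late≢ (ℕₚ.m≤n⇒m≤1+n (20≤last-index 1+p≡n)) (s≤s z≤n)
  rim-near-apart (wrap-edge₂ 1+p≡n) = rim-late≢ (ℕₚ.m≤n⇒m≤1+n (20≤last-index 1+p≡n)) ℕₚ.≤-refl

  rim<n : ∀ j → j < 2 * n → wheelRim j < n
  rim<n j j<2n with rim-small j
  ... | inj₁ r≤11 = ℕₚ.<-≤-trans (s≤s r≤11) 12≤n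
  ... | inj₂ 12≤j = ℕₚ.*-cancelˡ-< 2 _ _
    (ℕₚ.≤-<-trans (ℕₚ.m≤n+m _ 4) (ℕₚ.≤-<-trans (rim-below 12≤j) j<2n))

  rim-endpoint-apart : ∀ {e w} → Endpoint n e w → wheelRim (1 + 2 * e) ≢ w
  rim-endpoint-apart tail = proj₁ (rim-edge-apart _)
  rim-endpoint-apart (head inner) = proj₂ (rim-edge-apart _)
  rim-endpoint-apart {e} (head (closing _)) = odd≢even (rim-odd (1 + 2 * e)) refl

  wheelRim-isRimSequence : IsRimSequence n wheelRim
  wheelRim-isRimSequence = record
    { near-apart = rim-near-apart
    ; vertex-apart = rim-vertex-apart
    ; edge-apart = rim-endpoint-apart
    ; odd = rim-odd
    ; below = rim<n
    }

  large-wheel-coloring : HasTDTColoring (Wheel n) (suc n)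
  large-wheel-coloring =
    RimColoring.rim-coloring (ℕₚ.≤-trans (ℕₚ.≤ᵇ⇒≤ 3 12 _) 12≤n) wheelRim-isRimSequence

rimOf : List ℕ → ℕ → ℕ
rimOf [] _ = 0
rimOf (c ∷ cs) zero = c
rimOf (c ∷ cs) (suc j) = rimOf cs j

χ-wheel≡n+1 : ∀ {n} → HasTDTColoring (Wheel n) (suc n) → χdtt≡ (Wheel n) (suc n)
χ-wheel≡n+1 coloring = coloring , λ _ → wheel-colors≥

χ-wheel≡n+2 : ∀ {n} → HasTDTColoring (Wheel n) (2 + n) → ¬ HasTDTColoring (Wheel n) (suc n) →
              χdtt≡ (Wheel n) (2 + n)
χ-wheel≡n+2 coloring none = coloring , λ k has → ℕₚ.≤∧≢⇒< (wheel-colors≥ has) λ { refl → none has }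

coloring-W₃ : HasTDTColoring (Wheel 3) 5
coloring-W₃ = certify 5 (wheelColoring 3 4 (rimOf (1 ∷ 2 ∷ 3 ∷ 4 ∷ 0 ∷ 3 ∷ [])))

coloring-W₄ : HasTDTColoring (Wheel 4) 6
coloring-W₄ = certify 6 (wheelColoring 4 5 (rimOf (1 ∷ 5 ∷ 0 ∷ 4 ∷ 1 ∷ 5 ∷ 0 ∷ 4 ∷ [])))

coloring-W₅ : HasTDTColoring (Wheel 5) 7
coloring-W₅ = certify 7 (wheelColoring 5 6 (rimOf (1 ∷ 2 ∷ 3 ∷ 5 ∷ 1 ∷ 6 ∷ 4 ∷ 1 ∷ 0 ∷ 3 ∷ [])))

coloring-W₆ : HasTDTColoring (Wheel 6) 8
coloring-W₆ = certify 8 (wheelColoring 6 7 (rimOf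
  (1 ∷ 7 ∷ 0 ∷ 3 ∷ 6 ∷ 7 ∷ 4 ∷ 6 ∷ 3 ∷ 7 ∷ 0 ∷ 3 ∷ [])))

coloring-W₇ : HasTDTColoring (Wheel 7) 9
coloring-W₇ = certify 9 (wheelColoring 7 8 (rimOf
  (1 ∷ 8 ∷ 0 ∷ 3 ∷ 1 ∷ 8 ∷ 4 ∷ 5 ∷ 7 ∷ 3 ∷ 4 ∷ 8 ∷ 3 ∷ 5 ∷ [])))

coloring-W₈ : HasTDTColoring (Wheel 8) 9
coloring-W₈ = certify 9 (wheelColoring 8 8 (rimOf
  (1 ∷ 3 ∷ 5 ∷ 7 ∷ 1 ∷ 5 ∷ 7 ∷ 1 ∷ 3 ∷ 7 ∷ 1 ∷ 3 ∷ 5 ∷ 1 ∷ 3 ∷ 5 ∷ [])))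

coloring-W₉ : HasTDTColoring (Wheel 9) 10
coloring-W₉ = certify 10 (wheelColoring 9 9 (rimOf
  (1 ∷ 2 ∷ 4 ∷ 6 ∷ 1 ∷ 4 ∷ 6 ∷ 1 ∷ 8 ∷ 6 ∷ 4 ∷ 1 ∷ 8 ∷ 4 ∷ 6 ∷ 1 ∷ 4 ∷ 6 ∷ [])))

coloring-W₁₀ : HasTDTColoring (Wheel 10) 11
coloring-W₁₀ = certify 11 (wheelColoring 10 10 (rimOf
  (1 ∷ 2 ∷ 0 ∷ 4 ∷ 1 ∷ 6 ∷ 4 ∷ 1 ∷ 6 ∷ 8 ∷ 1 ∷ 4 ∷ 8 ∷ 1 ∷ 4 ∷ 6 ∷ 1 ∷ 4 ∷ 6 ∷ 8 ∷ [])))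

coloring-W₁₁ : HasTDTColoring (Wheel 11) 12
coloring-W₁₁ = certify 12 (wheelColoring 11 11 (rimOf
  (1 ∷ 2 ∷ 0 ∷ 3 ∷ 1 ∷ 5 ∷ 7 ∷ 1 ∷ 5 ∷ 7 ∷ 1 ∷ 9 ∷ 5 ∷ 1 ∷ 9 ∷ 5 ∷ 1 ∷ 7 ∷ 5 ∷ 1 ∷ 7 ∷ 5 ∷ [])))

small-wheel : ∀ m → m ≤ 4 → χdtt≡ (Wheel (3 + m)) (5 + m)
small-wheel 0 _ = χ-wheel≡n+2 coloring-W₃ (no-wheel-coloring 3 refl)
small-wheel 1 _ = χ-wheel≡n+2 coloring-W₄ (no-wheel-coloring 4 refl)
small-wheel 2 _ = χ-wheel≡n+2 coloring-W₅ (no-wheel-coloring 5 refl)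
small-wheel 3 _ = χ-wheel≡n+2 coloring-W₆ (no-wheel-coloring 6 refl)
small-wheel 4 _ = χ-wheel≡n+2 coloring-W₇ (no-wheel-coloring 7 refl)
small-wheel (4+ suc _) (s≤s (s≤s (s≤s (s≤s ()))))

wheel-coloring : ∀ m → HasTDTColoring (Wheel (8 + m)) (9 + m)
wheel-coloring 0 = coloring-W₈
wheel-coloring 1 = coloring-W₉
wheel-coloring 2 = coloring-W₁₀
wheel-coloring 3 = coloring-W₁₁
wheel-coloring (4+ m) = large-wheel-coloring (ℕₚ.m≤m+n 12 m)

χ-small-wheel : ∀ {n} → 3 ≤ n → n ≤ 7 → χdtt≡ (Wheel n) (n + 2)
χ-small-wheel 3≤n n≤7 with m , refl ← ℕₚ.m≤n⇒∃[o]m+o≡n 3≤n =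
  subst (χdtt≡ (Wheel (3 + m))) (ℕₚ.+-comm 2 (3 + m)) (small-wheel m (ℕₚ.+-cancelˡ-≤ 3 m 4 n≤7))

χ-large-wheel : ∀ {n} → 8 ≤ n → χdtt≡ (Wheel n) (n + 1)
χ-large-wheel 8≤n with m , refl ← ℕₚ.m≤n⇒∃[o]m+o≡n 8≤n =
  subst (χdtt≡ (Wheel (8 + m))) (ℕₚ.+-comm 1 (8 + m)) (χ-wheel≡n+1 (wheel-coloring m))

proposition2p3 : (n : ℕ) → 3 ≤ n →
    (n ≤ 7 → χdtt≡ (Wheel n) (n + 2)) × (8 ≤ n → χdtt≡ (Wheel n) (n + 1))
proposition2p3 n 3≤n = χ-small-wheel 3≤n , χ-large-wheel
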